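{- Let $\sigma$ be a signature and let $\Gamma\cup\{\psi\}$ be a set of $\mathcal{CO}[\sigma]$-, $\mathcal{CO}_{\sqcup}[\sigma]$- or $\mathcal{COD}[\sigma]$-formulas. Then $\Gamma\models^c\psi$ if and only if $\Gamma,\bigsqcup_{\mathcal F\in\mathbb F_\sigma}\Phi^{\mathcal F}\models^g\psi$.
   Context: Signature $\sigma=(\mathrm{Dom},\mathrm{Ran})$, $\mathrm{Dom}$ nonempty finite, each $\mathrm{Ran}(X)$ nonempty finite. $\mathbf X=\mathbf x$ abbreviates $X_1=x_1\wedge\dots\wedge X_n=x_n$, inconsistent if two conjuncts give distinct values to one variable. Assignments map $X$ into $\mathrm{Ran}(X)$. A system of functions $\mathcal F$: for $V\in\mathrm{En}(\mathcal F)\subseteq\mathrm{Dom}$, parents $PA^{\mathcal F}_V\subseteq\mathrm{Dom}\setminus\{V\}$ and $\mathcal F_V:\mathrm{Ran}(PA^{\mathcal F}_V)\to\mathrm{Ran}(V)$; $\mathrm{Ex}(\mathcal F)=\mathrm{Dom}\setminus\mathrm{En}(\mathcal F)$; recursive if the parent graph is acyclic; $\mathbb F_\sigma$ the finite set of all systems of functions; $s$ compatible with $\mathcal F$ if $s(V)=\mathcal F_V(s(PA^{\mathcal F}_V))$ for all endogenous $V$. Causal team: $(T^-,\mathcal F)$, $\mathcal F$ recursive, $T^-$ a set of compatible assignments (teams with empty $T^-$ identified as $\emptyset$); subteams $(S^-,\mathcal F)$, $S^-\subseteq T^-$. Generalized causal team: set of pairs $(s,\mathcal F)$, $\mathcal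 F$ recursive, $s$ compatible; $T^-=\{s:(s,\mathcal F)\in T\}$. Intervention (consistent $\mathbf X=\mathbf x$): $\mathcal F_{\mathbf X=\mathbf x}$ restricts $\mathcal F$ to $\mathrm{En}(\mathcal F)\setminus\mathbf X$; $s^{\mathcal F}_{\mathbf X=\mathbf x}$ is $x_i$ on $X_i$, $s(V)$ on $\mathrm{Ex}(\mathcal F)\setminus\mathbf X$, recursively $\mathcal F_V(s^{\mathcal F}_{\mathbf X=\mathbf x}(PA^{\mathcal F}_V))$ elsewhere; applied elementwise to teams, replacing $\mathcal F$ by $\mathcal F_{\mathbf X=\mathbf x}$. Languages: $\mathcal{CO}[\sigma]$: $\alpha::=X=x\mid\neg\alpha\mid\alpha\wedge\alpha\mid\alpha\vee\alpha\mid\mathbf X=\mathbf x\;\Box\!\!\rightarrow\alpha$; $\mathcal{CO}_{\sqcup}[\sigma]$ adds $\varphi\sqcup\varphi$ (negation only in front of $\mathcal{CO}$-formulas); $\mathcal{COD}[\sigma]$ adds dependence atoms ${=}(\mathbf X;Y)$ (negation only in front of $\mathcal{CO}$-formulas). Semantics on causal $T=(T^-,\mathcal F)$: $X=x$ iff all $s\in T^-$ have $s(X)=x$; ${=}(\mathbf X;Y)$ iff $s,s'\in T^-$, $s(\mathbf X)=s'(\mathbf X)$ imply $s(Y)=s'(Y)$; $\neg\alpha$ iff $(\{s\},\mathcal F)\not\models\alpha$ for all $s\in T^-$; $\wedge$ usual; $\varphi\vee\psi$ iff subteams $T_1,T_2$ with $T_1^-\cup T_2^-=T^-$ satisfy $\varphi,\psi$;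 $\varphi\sqcup\psi$ iff $T\models\varphi$ or $T\models\psi$; $\mathbf X=\mathbf x\;\Box\!\!\rightarrow\varphi$ iff inconsistent antecedent or $T_{\mathbf X=\mathbf x}\models\varphi$. Generalized: same with $T^-$ the team component, $\neg\alpha$ iff $\{(s,\mathcal F)\}\not\models\alpha$ for all elements, $\vee$ via $T=T_1\cup T_2$. $\Gamma\models^c\psi$ / $\Gamma\models^g\psi$: entailment over all causal / generalized causal teams over $\sigma$. Similarity $\sim$ of systems: $\mathcal F_V\sim\mathcal G_V$ iff $\mathcal F_V(\mathbf x\mathbf y)=\mathcal G_V(\mathbf x\mathbf z)$ for all $\mathbf x\in\mathrm{Ran}(PA^{\mathcal F}_V\cap PA^{\mathcal G}_V)$, $\mathbf y\in\mathrm{Ran}(PA^{\mathcal F}_V\setminus PA^{\mathcal G}_V)$, $\mathbf z\in\mathrm{Ran}(PA^{\mathcal G}_V\setminus PA^{\mathcal F}_V)$; $\mathrm{Cn}(\mathcal F)$ = endogenous $V$ with constant $\mathcal F_V$; $\mathcal F\sim\mathcal G$ iff $\mathrm{En}(\mathcal F)\setminus\mathrm{Cn}(\mathcal F)=\mathrm{En}(\mathcal G)\setminus\mathrm{Cn}(\mathcal G)$ and $\mathcal F_V\sim\mathcal G_V$ for these $V$. $\Phi^{\mathcal F}:=\bigwedge_{V\in\mathrm{En}(\mathcal F)\setminus\mathrm{Cn}(\mathcal F)}\eta_\sigma(V)\wedge\bigwedge_{V\in\mathrm{Dom}\setminus(\mathrm{En}(\mathcal F)\setminus\mathrm{Cn}(\mathcal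 F))}\xi_\sigma(V)$, $\eta_\sigma(V)$ the conjunction of all $(\mathbf W=\mathbf w\wedge PA^{\mathcal F}_V=\mathbf p)\;\Box\!\!\rightarrow V=\mathcal F_V(\mathbf p)$ ($\mathbf W$ listing $\mathrm{Dom}\setminus(PA^{\mathcal F}_V\cup\{V\})$, $\mathbf w\in\mathrm{Ran}(\mathbf W)$, $\mathbf p\in\mathrm{Ran}(PA^{\mathcal F}_V)$), $\xi_\sigma(V)$ the conjunction of all $\neg(V=v)\vee(\mathbf W_V=\mathbf w\;\Box\!\!\rightarrow V=v)$ ($v\in\mathrm{Ran}(V)$, $\mathbf W_V$ listing $\mathrm{Dom}\setminus\{V\}$, $\mathbf w\in\mathrm{Ran}(\mathbf W_V)$). $\bigsqcup$ denotes iterated global disjunction. -}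

module Defs where

open import Level using (Level) renaming (suc to lsuc; zero to lzero)
open import Data.Nat using (ℕ; _<_)
open import Data.Fin using (Fin; _≟_)
open import Data.Bool using (Bool; true; false; T; not; _∧_)
open import Data.Unit using (⊤; tt)
open import Data.Empty using (⊥)
open import Data.Product using (Σ; Σ-syntax; _×_; _,_; proj₁; proj₂)
open import Data.Sum using (_⊎_)
open import Data.List using (List; []; _∷_; map; filter; allFin)
open import Data.Bool.ListAction using (any)
open import Data.List.Membership.Propositional using (_∈_)
open import Relation.Nullary using (¬_; does; ¬?)
open import Relation.Binary.PropositionalEquality using (_≡_; _≢_)
open import Relation.Binary.Construct.Closure.Transitive using (TransClosure)

-- Signatures: Dom = Fin n (nonempty), Ran(X) = Fin (r X) (nonempty)

record Sig : Set where
  field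
    n        : ℕ
    r        : Fin n → ℕ
    Dom-ne   : 0 < n
    Ran-ne   : ∀ X → 0 < r X

data Lang : Set where
  CO COsq COD : Lang

allowsSq : Lang → Bool
allowsSq CO   = false
allowsSq COsq = true
allowsSq COD  = false

allowsDep : Lang → Bool
allowsDep CO   = false
allowsDep COsq = false
allowsDep COD  = true


module _ (σ : Sig) where
  open Sig σ

  Var : Set
  Var = Fin n

  Val : Var → Set
  Val X = Fin (r X)

  Assignment : Set
  Assignment = (X : Var) → Val X

  -- PA V X = true : X is a parent of V (only meaningful for endogenous V).
  -- fn V e : Ran(PA_V) → Ran(V), where an element of Ran(PA_V) is an
  --   assignment defined on the parents of V.
  record System : Set where
    field
      En       : Var → Bool
      PA       : Var → Var → Bool
      PA-irr   : ∀ V → T (PA V V) → ⊥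
      fn       : (V : Var) → T (En V) →
                 ((X : Var) → T (PA V X) → Val X) → Val V
      -- functions on Ran(PA_V) are functions of the values on PA_V
      fn-ext   : ∀ V e (p q : (X : Var) → T (PA V X) → Val X) →
                 (∀ X h → p X h ≡ q X h) → fn V e p ≡ fn V e q
  open System public

  Parent : System → Var → Var → Set
  Parent F X V = T (En F V) × T (PA F V X)

  Recursive : System → Set
  Recursive F = ∀ V → ¬ TransClosure (Parent F) V V

  restrict : (F : System) (V : Var) → Assignment → (X : Var) → T (PA F V X) → Val X
  restrict F V s X _ = s X

  Compatible : System → Assignment → Set
  Compatible F s = ∀ V (e : T (En F V)) → s V ≡ fn F V e (restrict F V s)

  -- Antecedents  X₁ = x₁ ∧ … ∧ Xₖ = xₖ  as lists of variable/value pairs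

  Antecedent : Set
  Antecedent = List (Σ Var Val)

  Inconsistent : Antecedent → Set
  Inconsistent a = Σ[ X ∈ Var ] Σ[ x ∈ Val X ] Σ[ x' ∈ Val X ]
                     ((X , x) ∈ a) × ((X , x') ∈ a) × (x ≢ x')

  inAnt : Var → Antecedent → Bool
  inAnt V a = any (λ p → does (proj₁ p ≟ V)) a

  T∧ˡ : ∀ a b → T (a ∧ b) → T a
  T∧ˡ true b _ = tt

  intervene : System → Antecedent → System
  intervene F a = record
    { En     = λ V → En F V ∧ not (inAnt V a)
    ; PA     = PA F
    ; PA-irr = PA-irr F
    ; fn     = λ V e → fn F V (T∧ˡ (En F V) _ e)
    ; fn-ext = λ V e → fn-ext F V (T∧ˡ (En F V) _ e)
    }

  -- Result F a s t :  t = s^F_{X=x}  (the defining equations of the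
  -- recursive definition; for recursive F they have a unique solution)
  record Result (F : System) (a : Antecedent) (s t : Assignment) : Set where
    field
      on-ant : ∀ X x → (X , x) ∈ a → t X ≡ x
      on-ex  : ∀ V → T (not (inAnt V a)) → En F V ≡ false → t V ≡ s V
      on-en  : ∀ V → T (not (inAnt V a)) → (e : T (En F V)) →
               t V ≡ fn F V e (restrict F V t)

  -- Formulas (one syntax; the three languages are carved out by InLang)

  data Fml : Set where
    eq    : (X : Var) → Val X → Fml
    neg   : Fml → Fml
    _∧'_  : Fml → Fml → Fml
    _∨'_  : Fml → Fml → Fml
    _⊔'_  : Fml → Fml → Fml
    _□→_  : Antecedent → Fml → Fml
    dep   : List Var → Var → Fml

  data IsCO : Fml → Set where
    eq   : ∀ X x → IsCO (eq X x)
    neg  : ∀ {α} → IsCO α → IsCO (neg α)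
    and  : ∀ {α β} → IsCO α → IsCO β → IsCO (α ∧' β)
    or   : ∀ {α β} → IsCO α → IsCO β → IsCO (α ∨' β)
    cf   : ∀ {a α} → IsCO α → IsCO (a □→ α)

  data InLang (L : Lang) : Fml → Set where
    eq   : ∀ X x → InLang L (eq X x)
    neg  : ∀ {α} → IsCO α → InLang L (neg α)
    and  : ∀ {φ ψ} → InLang L φ → InLang L ψ → InLang L (φ ∧' ψ)
    or   : ∀ {φ ψ} → InLang L φ → InLang L ψ → InLang L (φ ∨' ψ)
    sq   : ∀ {φ ψ} → T (allowsSq L) → InLang L φ → InLang L ψ → InLang L (φ ⊔' ψ)
    cf   : ∀ {a φ} → InLang L φ → InLang L (a □→ φ)
    dep  : ∀ Xs Y → T (allowsDep L) → InLang L (dep Xs Y)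

  ATeam : Set₁
  ATeam = Assignment → Set

  _⊆_ : ATeam → ATeam → Set
  A ⊆ B = ∀ s → A s → B s

  _∪_ : ATeam → ATeam → ATeam
  (A ∪ B) s = A s ⊎ B s

  _⊨c_ : ATeam × System → Fml → Set₁
  (Tm , F) ⊨c eq X x    = Level.Lift (lsuc lzero) (∀ s → Tm s → s X ≡ x)
  (Tm , F) ⊨c dep Xs Y  = Level.Lift (lsuc lzero) (∀ s s' → Tm s → Tm s' →
                              (∀ X → X ∈ Xs → s X ≡ s' X) → s Y ≡ s' Y)
  (Tm , F) ⊨c neg α     = ∀ s → Tm s → ¬ ((λ t → t ≡ s) , F) ⊨c α
  (Tm , F) ⊨c (φ ∧' ψ)  = ((Tm , F) ⊨c φ) × ((Tm , F) ⊨c ψ)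
  (Tm , F) ⊨c (φ ∨' ψ)  = Σ[ T₁ ∈ ATeam ] Σ[ T₂ ∈ ATeam ]
                            (T₁ ⊆ Tm) × (T₂ ⊆ Tm) × (Tm ⊆ (T₁ ∪ T₂)) ×
                            ((T₁ , F) ⊨c φ) × ((T₂ , F) ⊨c ψ)
  (Tm , F) ⊨c (φ ⊔' ψ)  = ((Tm , F) ⊨c φ) ⊎ ((Tm , F) ⊨c ψ)
  (Tm , F) ⊨c (a □→ φ)  = Level.Lift (lsuc lzero) (Inconsistent a) ⊎
                            (((λ t → Σ[ s ∈ Assignment ] Tm s × Result F a s t)
                              , intervene F a) ⊨c φ)

  GTeam : Set₁
  GTeam = Assignment → System → Set

  _⊆g_ : GTeam → GTeam → Set
  A ⊆g B = ∀ s F → A s F → B s F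

  _∪g_ : GTeam → GTeam → GTeam
  (A ∪g B) s F = A s F ⊎ B s F

  _⊨g_ : GTeam → Fml → Set₁
  Tm ⊨g eq X x    = Level.Lift (lsuc lzero) (∀ s F → Tm s F → s X ≡ x)
  Tm ⊨g dep Xs Y  = Level.Lift (lsuc lzero) (∀ s F s' F' → Tm s F → Tm s' F' →
                       (∀ X → X ∈ Xs → s X ≡ s' X) → s Y ≡ s' Y)
  Tm ⊨g neg α     = ∀ s F → Tm s F → ¬ ((λ t G → (t ≡ s) × (G ≡ F)) ⊨g α)
  Tm ⊨g (φ ∧' ψ)  = (Tm ⊨g φ) × (Tm ⊨g ψ)
  Tm ⊨g (φ ∨' ψ)  = Σ[ T₁ ∈ GTeam ] Σ[ T₂ ∈ GTeam ]
                       (T₁ ⊆g Tm) × (T₂ ⊆g Tm) × (Tm ⊆g (T₁ ∪g T₂)) ×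
                       (T₁ ⊨g φ) × (T₂ ⊨g ψ)
  Tm ⊨g (φ ⊔' ψ)  = (Tm ⊨g φ) ⊎ (Tm ⊨g ψ)
  Tm ⊨g (a □→ φ)  = Level.Lift (lsuc lzero) (Inconsistent a) ⊎
                       ((λ t H → Σ[ s ∈ Assignment ] Σ[ G ∈ System ]
                           Tm s G × Result G a s t × (H ≡ intervene G a)) ⊨g φ)

  IsCausalTeam : ATeam → System → Set
  IsCausalTeam Tm F = Recursive F × (∀ s → Tm s → Compatible F s)

  IsGTeam : GTeam → Set
  IsGTeam Tm = ∀ s F → Tm s F → Recursive F × Compatible F s

  antOf : Var → Assignment → Antecedent
  antOf V u = map (λ X → (X , u X)) (filter (λ X → ¬? (X ≟ V)) (allFin n))

  Const : (F : System) (V : Var) → T (En F V) → Set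
  Const F V e = ∀ p q → fn F V e p ≡ fn F V e q

  NonConst : System → Var → Set
  NonConst F V = Σ[ e ∈ T (En F V) ] ¬ Const F V e

  -- the conjuncts of η_σ(V):  (W = w ∧ PA_V = p) □→ V = F_V(p);
  -- an assignment u on Dom ∖ {V} gives w = u(W) and p = u(PA_V)
  ηconj : (F : System) (V : Var) → T (En F V) → Assignment → Fml
  ηconj F V e u = antOf V u □→ eq V (fn F V e (restrict F V u))

  ξconj : (V : Var) → Val V → Assignment → Fml
  ξconj V v u = neg (eq V v) ∨' (antOf V u □→ eq V v)

  -- T ⊨g Φ^F  (the big conjunction holds iff every conjunct holds)
  _⊨gΦ_ : GTeam → System → Set₁
  Tm ⊨gΦ F =
    (∀ V → (nc : NonConst F V) → ∀ u → Tm ⊨g ηconj F V (proj₁ nc) u) ×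
    (∀ V → ¬ NonConst F V → ∀ v u → Tm ⊨g ξconj V v u)

  -- T ⊨g ⨆_{F ∈ 𝔽_σ} Φ^F  (iterated global disjunction over all systems)
  _⊨g⨆Φ : GTeam → Set₁
  Tm ⊨g⨆Φ = Σ[ F ∈ System ] (Tm ⊨gΦ F)

  _⊨ᶜ_ : (Fml → Set) → Fml → Set₁
  Γ ⊨ᶜ ψ = ∀ (Tm : ATeam) (F : System) → IsCausalTeam Tm F →
           (∀ φ → Γ φ → (Tm , F) ⊨c φ) → (Tm , F) ⊨c ψ

  _,⨆Φ⊨ᵍ_ : (Fml → Set) → Fml → Set₁
  Γ ,⨆Φ⊨ᵍ ψ = ∀ (Tm : GTeam) → IsGTeam Tm →
              (∀ φ → Γ φ → Tm ⊨g φ) → Tm ⊨g⨆Φ → Tm ⊨g ψ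

-- If (T⁻, F) is a causal team, the generalized team {(s, F) | s ∈ T⁻} satisfies
-- the same formulas and satisfies Φ^F, which gives one direction.  Conversely,
-- let a generalized team satisfy Φ^F and let F° keep the non-constant
-- mechanisms of F with only their relevant parents.  For every (s, G) in the
-- team, η forces G_V = F_V for each non-constant V, and ξ forces every other
-- mechanism of G to be constantly s(V); so (s, G) answers every intervention
-- as (s, F°) does and the team satisfies the same formulas as the causal team
-- (T⁻, F°).  The parent graph of F° lies inside that of every G in the team:
-- if it has a cycle the team is empty and satisfies everything, otherwise
-- (T⁻, F°) is a causal team and the causal entailment applies.

module Submission where

open import Defs
open import Level using (lift; lower)
open import Data.Nat using (ℕ; zero; suc; _+_; _∸_; _≤_; s≤s⁻¹)
open import Data.Nat.Properties using (n<1+n; m∸n+n≡m; ≤-trans; ≤-refl)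
open import Data.Fin using (Fin; zero; suc; toℕ; fromℕ<; _≟_)
import Data.Fin.Properties as Fin
open import Data.Bool using (Bool; true; false; T; not; _∧_)
open import Data.Bool.Properties using (T?; T-irrelevant; T-∧; T-not-≡)
open import Data.Empty using (⊥-elim)
open import Data.List using (List; []; _∷_; length; filter; allFin)
open import Data.List.Properties using (filter-notAll)
open import Data.List.Membership.Propositional using (_∈_; find)
open import Data.List.Membership.Propositional.Properties
  using (∈-filter⁺; ∈-filter⁻; ∈-allFin; ∈-map⁺; ∈-map⁻)
open import Data.List.Relation.Unary.Any as Any using (here; there; any?)
open import Data.List.Relation.Unary.Any.Properties using (any⁺; any⁻)
open import Data.List.Relation.Unary.All as All using (All; all?)
open import Data.List.Relation.Unary.All.Properties.Core using (¬Any⇒All¬; ¬All⇒Any¬)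
open import Data.Product using (Σ; ∃; _×_; _,_; proj₁; proj₂; map₂)
open import Data.Sum using (_⊎_; inj₁; inj₂)
import Data.Sum as Sum
import Data.Product as Product
open import Function using (_∘_; case_of_)
open import Function.Bundles using (_⇔_; mk⇔; Equivalence)
open import Relation.Nullary using (¬_; Dec; yes; no; ¬?; does; isYes)
open import Relation.Nullary.Decidable
  using (decidable-stable; map′; toWitness; fromWitness; toWitnessFalse; _×-dec_)
open import Relation.Binary.Definitions using (Decidable)
open import Relation.Binary.PropositionalEquality
  using (_≡_; _≢_; refl; sym; trans; cong; subst; module ≡-Reasoning)
open import Relation.Binary.Construct.Closure.Transitive using (TransClosure; [_]; _∷_; _∷ʳ_)

TransClosure-map : ∀ {A : Set} {R₁ R₂ : A → A → Set} → (∀ {x y} → R₁ x y → R₂ x y) →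
                   ∀ {x y} → TransClosure R₁ x y → TransClosure R₂ x y
TransClosure-map f [ r ]   = [ f r ]
TransClosure-map f (r ∷ p) = f r ∷ TransClosure-map f p

T⊎≡false : ∀ b → T b ⊎ b ≡ false
T⊎≡false true  = inj₁ _
T⊎≡false false = inj₂ refl

∧-≡false : ∀ x {y} → T y → x ∧ y ≡ false → x ≡ false
∧-≡false false _ _ = refl
∧-≡false true {true} _ ()

T-not : ∀ {b} → ¬ T b → T (not b)
T-not {false} _   = _
T-not {true}  ¬tt = ¬tt _

T-not⁻ : ∀ {b} → T (not b) → ¬ T b
T-not⁻ {false} _ ()

T-does-≟ : ∀ {k} {X Y : Fin k} → T (does (X ≟ Y)) → X ≡ Y
T-does-≟ {X = X} {Y} _ with X ≟ Y
... | yes X≡Y = X≡Y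

T-does-≟-refl : ∀ {k} {X : Fin k} → T (does (X ≟ X))
T-does-≟-refl {X = X} with X ≟ X
... | yes _  = _
... | no X≢X = X≢X refl

any-Π? : ∀ {k} {r : Fin k → ℕ} {P : ((X : Fin k) → Fin (r X)) → Set} →
         (∀ {u v} → (∀ X → u X ≡ v X) → P u → P v) → (∀ u → Dec (P u)) → Dec (∃ P)
any-Π? {zero} {P = P} resp P? = map′ (_ ,_) from-any (P? λ ())
  where
  from-any : ∃ P → P (λ ())
  from-any (_ , Pu) = resp (λ ()) Pu
any-Π? {suc k} {r} {P} resp P? =
  map′ to-any from-any (Fin.any? λ a → any-Π? (resp ∘ cons-cong) (P? ∘ (cons a)))
  where
  Tail : Set
  Tail = (X : Fin k) → Fin (r (suc X))
  cons : Fin (r zero) → Tail → (X : Fin (suc k)) → Fin (r X)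
  cons a u zero    = a
  cons a u (suc X) = u X
  cons-cong : ∀ {a} {u v : Tail} → (∀ X → u X ≡ v X) → ∀ X → cons a u X ≡ cons a v X
  cons-cong u≗v zero    = refl
  cons-cong u≗v (suc X) = u≗v X
  to-any : (∃ λ a → ∃ λ (u : Tail) → P (cons a u)) → ∃ P
  to-any (a , u , P[a∷u]) = cons a u , P[a∷u]
  from-any : ∃ P → ∃ λ a → ∃ λ (u : Tail) → P (cons a u)
  from-any (u , Pu) = u zero , u ∘ suc , resp cons-η Pu
    where
    cons-η : ∀ X → u X ≡ cons (u zero) (u ∘ suc) X
    cons-η zero    = refl
    cons-η (suc X) = refl

module Acyclicity {k : ℕ} {R : Fin k → Fin k → Set} (R? : Decidable R) where

  Cyclic : Set
  Cyclic = ∃ λ x → TransClosure R x x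

  Acyclic : Set
  Acyclic = ∀ x → ¬ TransClosure R x x

  private
    Within : List (Fin k) → Fin k → Fin k → Set
    Within S x y = x ∈ S × y ∈ S × R x y

    _without_ : List (Fin k) → Fin k → List (Fin k)
    S without v = filter (λ x → ¬? (x ≟ v)) S

    Sink : List (Fin k) → Fin k → Set
    Sink S v = ∀ {y} → y ∈ S → ¬ R v y

    ∈-without⁺ : ∀ {S v x} → x ∈ S → x ≢ v → x ∈ S without v
    ∈-without⁺ {v = v} = ∈-filter⁺ (λ x → ¬? (x ≟ v))

    sink-not-source : ∀ {S v x y} → Sink S v → TransClosure (Within S) x y → x ≢ v
    sink-not-source sink [ _ , y∈S , xRy ]       refl = sink y∈S xRy
    sink-not-source sink ((_ , y∈S , xRy) ∷ _) refl = sink y∈S xRy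

    remove-sink : ∀ {S v x y} → Sink S v → TransClosure (Within S) x y → y ≢ v →
                  TransClosure (Within (S without v)) x y
    remove-sink sink x⁺y@([ x∈S , y∈S , xRy ]) y≢v =
      [ ∈-without⁺ x∈S (sink-not-source sink x⁺y) , ∈-without⁺ y∈S y≢v , xRy ]
    remove-sink sink x⁺y@((x∈S , z∈S , xRz) ∷ z⁺y) y≢v =
      (∈-without⁺ x∈S (sink-not-source sink x⁺y) ,
       ∈-without⁺ z∈S (sink-not-source sink z⁺y) , xRz)
        ∷ remove-sink sink z⁺y y≢v

    module Walk {S : List (Fin k)} (successor : ∀ {v} → v ∈ S → ∃ λ y → y ∈ S × R v y)
                {x₀ : Fin k} (x₀∈S : x₀ ∈ S) where
      walk : ℕ → ∃ (_∈ S)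
      walk zero    = x₀ , x₀∈S
      walk (suc i) = map₂ proj₁ (successor (proj₂ (walk i)))

      position : ℕ → Fin k
      position i = proj₁ (walk i)

      step : ∀ i → R (position i) (position (suc i))
      step i = proj₂ (proj₂ (successor (proj₂ (walk i))))

      path : ∀ i d → TransClosure R (position i) (position (d + suc i))
      path i zero    = [ step i ]
      path i (suc d) = path i d ∷ʳ step (d + suc i)

      -- the positions 0, …, k visit only k vertices
      cycle : Cyclic
      cycle with Fin.pigeonhole (n<1+n k) (λ i → position (toℕ i))
      ... | i , j , i<j , same = position (toℕ i) ,
            subst (TransClosure R (position (toℕ i)))
                  (trans (cong position (m∸n+n≡m i<j)) (sym same))
                  (path (toℕ i) (toℕ j ∸ suc (toℕ i)))

    -- Either some v ∈ S has no successor in S, so lies on no cycle within S and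
    -- can be removed, or every vertex of S has one and a walk inside S never stops.
    cyclic-or-acyclic-within : ∀ m S → length S ≤ m →
                               Cyclic ⊎ (∀ x → ¬ TransClosure (Within S) x x)
    cyclic-or-acyclic-within _ [] _ = inj₂ λ { _ [ () , _ ] ; _ ((() , _) ∷ _) }
    cyclic-or-acyclic-within zero (_ ∷ _) ()
    cyclic-or-acyclic-within (suc m) S@(_ ∷ _) |S|≤1+m
      with any? (λ v → all? (λ y → ¬? (R? v y)) S) S
    ... | no ¬∃sink = inj₁ (Walk.cycle successor (here refl))
      where
      successor : ∀ {v} → v ∈ S → ∃ λ y → y ∈ S × R v y
      successor {v} v∈S
        with find (¬All⇒Any¬ (λ y → ¬? (R? v y)) S (All.lookup (¬Any⇒All¬ S ¬∃sink) v∈S))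
      ... | y , y∈S , ¬¬vRy = y , y∈S , decidable-stable (R? v y) ¬¬vRy
    ... | yes ∃sink with find ∃sink
    ... | v , v∈S , sink
      with cyclic-or-acyclic-within m (S without v)
             (s≤s⁻¹ (≤-trans (filter-notAll (λ x → ¬? (x ≟ v)) S
                               (Any.map (λ v≡x x≢v → x≢v (sym v≡x)) v∈S)) |S|≤1+m))
    ... | inj₁ cyclic  = inj₁ cyclic
    ... | inj₂ acyclic = inj₂ λ x x⁺x →
            acyclic x (remove-sink (All.lookup sink) x⁺x (sink-not-source (All.lookup sink) x⁺x))

  cyclic-or-acyclic : Cyclic ⊎ Acyclic
  cyclic-or-acyclic with cyclic-or-acyclic-within (length (allFin k)) (allFin k) ≤-refl
  ... | inj₁ cyclic  = inj₁ cyclic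
  ... | inj₂ acyclic = inj₂ λ x x⁺x →
          acyclic x (TransClosure-map (λ {x} {y} xRy → ∈-allFin x , ∈-allFin y , xRy) x⁺x)

module _ {σ : Sig} where
  open Sig σ

  private
    variable
      F G : System σ
      s t u u' : Assignment σ
      V X Y : Var σ
      a : Antecedent σ

  default : (X : Var σ) → Val σ X
  default X = fromℕ< (Ran-ne X)

  _[_≔_] : Assignment σ → (X : Var σ) → Val σ X → Assignment σ
  (u [ X ≔ x ]) Y with X ≟ Y
  ... | yes refl = x
  ... | no _     = u Y

  update-≡ : ∀ (u : Assignment σ) X x → (u [ X ≔ x ]) X ≡ x
  update-≡ u X x with X ≟ X
  ... | yes refl = refl
  ... | no X≢X   = ⊥-elim (X≢X refl)

  update-≢ : ∀ (u : Assignment σ) {X} x {Y} → X ≢ Y → (u [ X ≔ x ]) Y ≡ u Y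
  update-≢ u {X} x {Y} X≢Y with X ≟ Y
  ... | yes X≡Y = ⊥-elim (X≢Y X≡Y)
  ... | no _    = refl

  update-cong : ∀ {X} x → (∀ Y → u Y ≡ u' Y) → ∀ Y → (u [ X ≔ x ]) Y ≡ (u' [ X ≔ x ]) Y
  update-cong {X = X} x u≡u' Y with X ≟ Y
  ... | yes refl = refl
  ... | no _     = u≡u' Y

  update-redundant : ∀ {X x} → u X ≡ x → ∀ Y → u Y ≡ (u [ X ≔ x ]) Y
  update-redundant {X = X} uX≡x Y with X ≟ Y
  ... | yes refl = uX≡x
  ... | no _     = refl

  eval : (F : System σ) (V : Var σ) → T (En F V) → Assignment σ → Val σ V
  eval F V e u = fn F V e (restrict σ F V u)

  eval-cong : ∀ {e} → (∀ X → T (PA F V X) → u X ≡ u' X) → eval F V e u ≡ eval F V e u'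
  eval-cong {F} {V} {e = e} u≡u' = fn-ext F V e _ _ u≡u'

  eval-irrelevant : ∀ (e e' : T (En F V)) u → eval F V e u ≡ eval F V e' u
  eval-irrelevant {F} {V} e e' u = cong (λ e → eval F V e u) (T-irrelevant e e')

  eval-update-nonparent : ∀ {e} x → ¬ T (PA F V X) → eval F V e (u [ X ≔ x ]) ≡ eval F V e u
  eval-update-nonparent {F} {V} {X} {u} x X∉PA =
    eval-cong {F = F} λ Y Y∈PA → update-≢ u x λ { refl → X∉PA Y∈PA }

  Relevant : (F : System σ) (V : Var σ) → T (En F V) → Var σ → Set
  Relevant F V e X = ∃ λ u → ∃ λ x → eval F V e u ≢ eval F V e (u [ X ≔ x ])

  relevant? : ∀ F V e X → Dec (Relevant F V e X)
  relevant? F V e X = any-Π? resp λ u → Fin.any? λ x → ¬? (eval F V e u ≟ eval F V e (u [ X ≔ x ]))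
    where
    resp : (∀ Y → u Y ≡ u' Y) → (∃ λ x → eval F V e u ≢ eval F V e (u [ X ≔ x ])) →
                                 ∃ λ x → eval F V e u' ≢ eval F V e (u' [ X ≔ x ])
    resp u≡u' (x , differs) = x , λ same → differs
      (trans (eval-cong {F = F} λ Y _ → u≡u' Y)
        (trans same (eval-cong {F = F} λ Y _ → sym (update-cong x u≡u' Y))))

  irrelevant : ∀ {e} → ¬ Relevant F V e X → ∀ u x → eval F V e u ≡ eval F V e (u [ X ≔ x ])
  irrelevant {F} {V} {e = e} ¬relevant u x =
    decidable-stable (eval F V e u ≟ _) λ differs → ¬relevant (u , x , differs)

  self-irrelevant : ∀ {e} → ¬ Relevant F V e V
  self-irrelevant {F} {V} (u , x , differs) = differs (sym (eval-update-nonparent {F = F} x (PA-irr F V)))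

  -- Turn u into u' one variable at a time: each step changes an irrelevant
  -- variable or one where the two already agree.
  eval-≡-on-relevant : ∀ {e} → (∀ X → Relevant F V e X → u X ≡ u' X) →
                       eval F V e u ≡ eval F V e u'
  eval-≡-on-relevant {F} {V} {u} {u'} {e} u≡u' = go (allFin n) u u≡u' λ X _ → ∈-allFin X
    where
    go : ∀ L w → (∀ X → Relevant F V e X → w X ≡ u' X) → (∀ X → w X ≢ u' X → X ∈ L) →
         eval F V e w ≡ eval F V e u'
    go [] w _ differ∈[] = eval-cong {F = F} λ X _ → decidable-stable (w X ≟ u' X) λ w≢u' →
      case differ∈[] X w≢u' of λ ()
    go (X ∷ L) w w≡u' differ∈X∷L = trans step (go L (w [ X ≔ u' X ]) w'≡u' differ∈L)
      where
      step : eval F V e w ≡ eval F V e (w [ X ≔ u' X ])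
      step with relevant? F V e X
      ... | yes relevant = eval-cong {F = F} λ Y _ → update-redundant (w≡u' X relevant) Y
      ... | no ¬relevant = irrelevant {F = F} ¬relevant w (u' X)
      w'≡u' : ∀ Y → Relevant F V e Y → (w [ X ≔ u' X ]) Y ≡ u' Y
      w'≡u' Y relevant with X ≟ Y
      ... | yes refl = refl
      ... | no _     = w≡u' Y relevant
      differ∈L : ∀ Y → (w [ X ≔ u' X ]) Y ≢ u' Y → Y ∈ L
      differ∈L Y w'≢u' with X ≟ Y
      ... | yes refl = ⊥-elim (w'≢u' refl)
      ... | no X≢Y with differ∈X∷L Y w'≢u'
      ...   | here Y≡X  = ⊥-elim (X≢Y (sym Y≡X))
      ...   | there Y∈L = Y∈L

  extend : (P : Var σ → Bool) → ((X : Var σ) → T (P X) → Val σ X) → Assignment σ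
  extend P p X with T? (P X)
  ... | yes X∈P = p X X∈P
  ... | no _    = default X

  extend-inside : ∀ P p X (X∈P : T (P X)) → extend P p X ≡ p X X∈P
  extend-inside P p X X∈P with T? (P X)
  ... | yes X∈P' = cong (p X) (T-irrelevant X∈P' X∈P)
  ... | no X∉P   = ⊥-elim (X∉P X∈P)

  fn-as-eval : ∀ F V e p → fn F V e p ≡ eval F V e (extend (PA F V) p)
  fn-as-eval F V e p = fn-ext F V e _ _ λ X X∈PA → sym (extend-inside (PA F V) p X X∈PA)

  invariant⇒Const : ∀ {e} → (∀ u u' → eval F V e u ≡ eval F V e u') → Const σ F V e
  invariant⇒Const {F} {V} {e} invariant p q =
    trans (fn-as-eval F V e p) (trans (invariant _ _) (sym (fn-as-eval F V e q)))

  relevant⇒¬Const : ∀ {e} → Relevant F V e X → ¬ Const σ F V e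
  relevant⇒¬Const (u , x , differs) constant = differs (constant _ _)

  ¬relevant⇒Const : ∀ {e} → (∀ X → ¬ Relevant F V e X) → Const σ F V e
  ¬relevant⇒Const {F} ¬relevant =
    invariant⇒Const {F = F} λ u u' →
      eval-≡-on-relevant {F = F} λ X relevant → ⊥-elim (¬relevant X relevant)

  RelevantParent : System σ → Var σ → Var σ → Set
  RelevantParent F V X = Σ (T (En F V)) λ e → Relevant F V e X

  relevantParent? : ∀ F V X → Dec (RelevantParent F V X)
  relevantParent? F V X with T? (En F V)
  ... | yes e = map′ (e ,_)
                     (λ (e' , relevant) → subst (λ e → Relevant F V e X) (T-irrelevant e' e) relevant)
                     (relevant? F V e X)
  ... | no ¬e = no (¬e ∘ proj₁)

  hasRelevantParent? : ∀ F V → Dec (∃ (RelevantParent F V))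
  hasRelevantParent? F V = Fin.any? (relevantParent? F V)

  core-en : ∀ {F V} → T (isYes (hasRelevantParent? F V)) → T (En F V)
  core-en {F} {V} h = proj₁ (proj₂ (toWitness {a? = hasRelevantParent? F V} h))

  extend-cong : ∀ {P} p q → (∀ X h → p X h ≡ q X h) → ∀ X → extend P p X ≡ extend P q X
  extend-cong {P} p q p≡q X with T? (P X)
  ... | yes X∈P = p≡q X X∈P
  ... | no _    = refl

  -- F° of the proof idea: since a mechanism is constant iff it has no relevant
  -- parent, its endogenous variables are exactly En(F) ∖ Cn(F).
  core : System σ → System σ
  core F = record
    { En     = λ V → isYes (hasRelevantParent? F V)
    ; PA     = λ V X → isYes (relevantParent? F V X)
    ; PA-irr = λ V V∈PA → self-irrelevant {F = F} (proj₂ (toWitness {a? = relevantParent? F V V} V∈PA))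
    ; fn     = λ V h p → eval F V (core-en {F = F} h) (extend (λ X → isYes (relevantParent? F V X)) p)
    ; fn-ext = λ V h p q p≡q → eval-cong {F = F} λ X _ → extend-cong p q p≡q X
    }

  core-eval : ∀ (h : T (En (core F) V)) u → eval (core F) V h u ≡ eval F V (core-en {F = F} h) u
  core-eval {F} {V} h u = eval-≡-on-relevant {F = F} λ X relevant →
    extend-inside _ (restrict σ (core F) V u) X (fromWitness (core-en {F = F} h , relevant))

  core-endogenous⇒NonConst : T (En (core F) V) → NonConst σ F V
  core-endogenous⇒NonConst {F} {V} h with toWitness {a? = hasRelevantParent? F V} h
  ... | X , e , relevant = e , relevant⇒¬Const {F = F} relevant

  core-exogenous⇒¬NonConst : En (core F) V ≡ false → ¬ NonConst σ F V
  core-exogenous⇒¬NonConst {F} {V} exogenous (e , ¬constant) =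
    ¬constant (¬relevant⇒Const {F = F} λ X relevant → toWitnessFalse {a? = hasRelevantParent? F V} (Equivalence.from T-not-≡ exogenous) (X , e , relevant))

  antOf-∈⁻ : ∀ {X x} → (X , x) ∈ antOf σ V u → X ≢ V × x ≡ u X
  antOf-∈⁻ {V} {u} X,x∈ with ∈-map⁻ (λ X → (X , u X)) X,x∈
  ... | _ , X∈ , refl = proj₂ (∈-filter⁻ (λ X → ¬? (X ≟ V)) {xs = allFin n} X∈) , refl

  antOf-∈⁺ : X ≢ V → (X , u X) ∈ antOf σ V u
  antOf-∈⁺ {X} {V} {u} X≢V =
    ∈-map⁺ (λ X → (X , u X)) (∈-filter⁺ (λ X → ¬? (X ≟ V)) (∈-allFin X) X≢V)

  antOf-consistent : ¬ Inconsistent σ (antOf σ V u)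
  antOf-consistent (X , x , x' , X,x∈ , X,x'∈ , x≢x') =
    x≢x' (trans (proj₂ (antOf-∈⁻ X,x∈)) (sym (proj₂ (antOf-∈⁻ X,x'∈))))

  antOf-omits : T (not (inAnt σ V (antOf σ V u)))
  antOf-omits {V} {u} = T-not λ V∈ → case find (any⁻ _ (antOf σ V u) V∈) of λ
    { ((X , _) , X,x∈ , X≟V) → proj₁ (antOf-∈⁻ X,x∈) (T-does-≟ X≟V) }

  antOf-omits-only : T (not (inAnt σ Y (antOf σ V u))) → Y ≡ V
  antOf-omits-only {Y} {V} {u} Y∉ with Y ≟ V
  ... | yes Y≡V = Y≡V
  ... | no Y≢V  =
    ⊥-elim (T-not⁻ Y∉ (any⁺ _ (Any.map (λ { refl → T-does-≟-refl {X = Y} }) (antOf-∈⁺ {u = u} Y≢V))))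

  fixOthers-endogenous : Result σ G (antOf σ V u) s t → (e : T (En G V)) → t V ≡ eval G V e u
  fixOthers-endogenous {G} {V} {u} {t = t} R e =
    trans (Result.on-en R V antOf-omits e) (eval-cong {F = G} t≡u)
    where
    t≡u : ∀ X → T (PA G V X) → t X ≡ u X
    t≡u X X∈PA = Result.on-ant R X (u X) (antOf-∈⁺ λ { refl → PA-irr G V X∈PA })

  fixOthers-exogenous : Result σ G (antOf σ V u) s t → En G V ≡ false → t V ≡ s V
  fixOthers-exogenous {V = V} R = Result.on-ex R V antOf-omits

  fixOthers-to : ∀ {G s u V} c → (∀ e → c ≡ eval G V e u) → (En G V ≡ false → c ≡ s V) →
                 Result σ G (antOf σ V u) s (u [ V ≔ c ])
  fixOthers-to {G} {s} {u} {V} c endogenous exogenous = record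
    { on-ant = λ X x X,x∈ → let X≢V , x≡uX = antOf-∈⁻ X,x∈ in
                 trans (update-≢ u c (X≢V ∘ sym)) (sym x≡uX)
    ; on-ex  = λ { Y Y∉ ex → case antOf-omits-only Y∉ of λ { refl →
                 trans (update-≡ u V c) (exogenous ex) } }
    ; on-en  = λ { Y Y∉ e → case antOf-omits-only Y∉ of λ { refl →
                 trans (update-≡ u V c) (trans (endogenous e) (eval-cong {F = G} λ X X∈PA →
                   sym (update-≢ u c λ { refl → PA-irr G V X∈PA }))) } }
    }

  fixOthers : ∀ G s u V → ∃ (Result σ G (antOf σ V u) s)
  fixOthers G s u V with T? (En G V)
  ... | yes e = _ , fixOthers-to (eval G V e u) (λ e' → eval-irrelevant {F = G} e e' u)
                                 λ ex → ⊥-elim (subst T ex e)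
  ... | no ¬e = _ , fixOthers-to (s V) (⊥-elim ∘ ¬e) λ _ → refl

  record Agree (F G : System σ) (s : Assignment σ) : Set where
    field
      endogenous : T (En F V) → T (En G V)
      mechanism  : (e : T (En F V)) (e' : T (En G V)) → ∀ u → eval G V e' u ≡ eval F V e u
      exogenous  : En F V ≡ false → (e' : T (En G V)) → ∀ u → eval G V e' u ≡ s V

  agree-refl : Agree F F s
  agree-refl {F} = record
    { endogenous = λ e → e
    ; mechanism  = λ e e' u → eval-irrelevant {F = F} e' e u
    ; exogenous  = λ ex e → ⊥-elim (subst T ex e)
    }

  agree-compatible : Agree F G s → Compatible σ G s → Compatible σ F s
  agree-compatible {s = s} agree compatible V e =
    trans (compatible V (Agree.endogenous agree e)) (Agree.mechanism agree e _ s)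

  agree-result : Agree F G s → Result σ F a s t → Result σ G a s t
  agree-result {F} {G} {s} {t = t} agree R = record
    { on-ant = Result.on-ant R
    ; on-ex  = λ V V∉ exG → case T⊎≡false (En F V) of λ
        { (inj₁ e)   → ⊥-elim (subst T exG (endogenous e))
        ; (inj₂ exF) → Result.on-ex R V V∉ exF }
    ; on-en  = λ V V∉ e' → case T⊎≡false (En F V) of λ
        { (inj₁ e)   → trans (Result.on-en R V V∉ e) (sym (mechanism e e' t))
        ; (inj₂ exF) → trans (Result.on-ex R V V∉ exF) (sym (exogenous exF e' t)) }
    }
    where open Agree agree

  agree-result⁻ : Agree F G s → Result σ G a s t → Result σ F a s t
  agree-result⁻ {F} {G} {s} {t = t} agree R = record
    { on-ant = Result.on-ant R
    ; on-ex  = λ V V∉ exF → case T⊎≡false (En G V) of λ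
        { (inj₁ e')  → trans (Result.on-en R V V∉ e') (exogenous exF e' t)
        ; (inj₂ exG) → Result.on-ex R V V∉ exG }
    ; on-en  = λ V V∉ e → trans (Result.on-en R V V∉ (endogenous e)) (mechanism e _ t)
    }
    where open Agree agree

  agree-intervene : Agree F G s → Result σ G a s t → Agree (intervene σ F a) (intervene σ G a) t
  agree-intervene {F} {G} {s} {a} {t} agree R = record
    { endogenous = λ {V} e → let eF , V∉ = Equivalence.to T-∧ e in
                     Equivalence.from T-∧ (endogenous eF , V∉)
    ; mechanism  = λ e e' → mechanism (T∧ˡ σ _ _ e) (T∧ˡ σ _ _ e')
    ; exogenous  = λ {V} ex e' u → let eG , V∉ = Equivalence.to T-∧ e'
                                       exF = ∧-≡false (En F V) V∉ ex in
                     trans (eval-irrelevant {F = G} _ eG u) (trans (exogenous exF eG u)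
                       (sym (trans (Result.on-en R V V∉ eG) (exogenous exF eG t))))
    }
    where open Agree agree

  record Represents (Tm : ATeam σ) (F : System σ) (Tg : GTeam σ) : Set where
    field
      covers : Tm s → Σ (System σ) (Tg s)
      member : Tg s G → Tm s
      agrees : Tg s G → Agree F G s

  represents-singleton : Agree F G s →
                         Represents (λ t → t ≡ s) F (λ t H → (t ≡ s) × (H ≡ G))
  represents-singleton {G = G} agree = record
    { covers = λ t≡s → G , t≡s , refl
    ; member = proj₁
    ; agrees = λ { (refl , refl) → agree }
    }

  represents-⊆ᶜ : ∀ {Tm T₁ Tg} → Represents Tm F Tg → _⊆_ σ T₁ Tm →
                  Represents T₁ F (λ s G → Tg s G × T₁ s)
  represents-⊆ᶜ rep T₁⊆Tm = record
    { covers = λ t₁ → let G , g = covers (T₁⊆Tm _ t₁) in G , g , t₁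
    ; member = proj₂
    ; agrees = agrees ∘ proj₁
    }
    where open Represents rep

  represents-⊆ᵍ : ∀ {Tm Tg T₁} → Represents Tm F Tg → _⊆g_ σ T₁ Tg →
                  Represents (λ s → Σ (System σ) (T₁ s)) F T₁
  represents-⊆ᵍ rep T₁⊆Tg = record
    { covers = λ g₁ → g₁
    ; member = λ g₁ → _ , g₁
    ; agrees = λ g₁ → agrees (T₁⊆Tg _ _ g₁)
    }
    where open Represents rep

  represents-intervene : ∀ {Tm Tg} → Represents Tm F Tg →
    Represents (λ t → Σ (Assignment σ) λ s → Tm s × Result σ F a s t) (intervene σ F a)
               (λ t H → Σ (Assignment σ) λ s → Σ (System σ) λ G →
                          Tg s G × Result σ G a s t × (H ≡ intervene σ G a))
  represents-intervene {a = a} rep = record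
    { covers = λ (s , ts , R) → let G , g = covers ts in
                 intervene σ G a , s , G , g , agree-result (agrees g) R , refl
    ; member = λ { (s , G , g , R , refl) → s , member g , agree-result⁻ (agrees g) R }
    ; agrees = λ { (s , G , g , R , refl) → agree-intervene (agrees g) R }
    }
    where open Represents rep

  ⊨-transfer : ∀ {Tm F Tg} φ → Represents Tm F Tg → _⊨c_ σ (Tm , F) φ ⇔ _⊨g_ σ Tg φ
  ⊨-transfer (eq X x) rep = mk⇔
    (λ h → lift λ s G g → lower h s (member g))
    (λ h → lift λ s ts → lower h s _ (proj₂ (covers ts)))
    where open Represents rep
  ⊨-transfer (dep Xs Y) rep = mk⇔
    (λ h → lift λ s G s' G' g g' → lower h s s' (member g) (member g'))
    (λ h → lift λ s s' ts ts' → lower h s _ s' _ (proj₂ (covers ts)) (proj₂ (covers ts')))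
    where open Represents rep
  ⊨-transfer {F = F} {Tg} (neg α) rep = mk⇔
    (λ h s G g sat → h s (member g) (Equivalence.from (singleton g) sat))
    (λ h s ts sat → h s _ (proj₂ (covers ts)) (Equivalence.to (singleton (proj₂ (covers ts))) sat))
    where
    open Represents rep
    singleton : ∀ {s G} → Tg s G →
                _⊨c_ σ ((λ t → t ≡ s) , F) α ⇔ _⊨g_ σ (λ t H → (t ≡ s) × (H ≡ G)) α
    singleton {s} {G} g = ⊨-transfer α (represents-singleton {G = G} {s = s} (agrees g))
  ⊨-transfer (φ ∧' ψ) rep = mk⇔
    (Product.map (Equivalence.to (⊨-transfer φ rep)) (Equivalence.to (⊨-transfer ψ rep)))
    (Product.map (Equivalence.from (⊨-transfer φ rep)) (Equivalence.from (⊨-transfer ψ rep)))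
  ⊨-transfer (φ ⊔' ψ) rep = mk⇔
    (Sum.map (Equivalence.to (⊨-transfer φ rep)) (Equivalence.to (⊨-transfer ψ rep)))
    (Sum.map (Equivalence.from (⊨-transfer φ rep)) (Equivalence.from (⊨-transfer ψ rep)))
  ⊨-transfer (a □→ φ) rep = mk⇔
    (Sum.map₂ (Equivalence.to (⊨-transfer φ (represents-intervene rep))))
    (Sum.map₂ (Equivalence.from (⊨-transfer φ (represents-intervene rep))))
  ⊨-transfer {Tm} {F} {Tg} (φ ∨' ψ) rep = mk⇔ split-g split-c
    where
    open Represents rep
    split-g : _⊨c_ σ (Tm , F) (φ ∨' ψ) → _⊨g_ σ Tg (φ ∨' ψ)
    split-g (T₁ , T₂ , T₁⊆Tm , T₂⊆Tm , Tm⊆T₁∪T₂ , h₁ , h₂) =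
      (λ s G → Tg s G × T₁ s) , (λ s G → Tg s G × T₂ s) ,
      (λ _ _ → proj₁) , (λ _ _ → proj₁) ,
      (λ s G g → Sum.map (g ,_) (g ,_) (Tm⊆T₁∪T₂ s (member g))) ,
      Equivalence.to (⊨-transfer φ (represents-⊆ᶜ rep T₁⊆Tm)) h₁ ,
      Equivalence.to (⊨-transfer ψ (represents-⊆ᶜ rep T₂⊆Tm)) h₂
    split-c : _⊨g_ σ Tg (φ ∨' ψ) → _⊨c_ σ (Tm , F) (φ ∨' ψ)
    split-c (T₁ , T₂ , T₁⊆Tg , T₂⊆Tg , Tg⊆T₁∪T₂ , h₁ , h₂) =
      (λ s → Σ (System σ) (T₁ s)) , (λ s → Σ (System σ) (T₂ s)) ,
      (λ s (G , g₁) → member (T₁⊆Tg s G g₁)) , (λ s (G , g₂) → member (T₂⊆Tg s G g₂)) ,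
      (λ s ts → let G , g = covers ts in Sum.map (G ,_) (G ,_) (Tg⊆T₁∪T₂ s G g)) ,
      Equivalence.from (⊨-transfer φ (represents-⊆ᵍ rep T₁⊆Tg)) h₁ ,
      Equivalence.from (⊨-transfer ψ (represents-⊆ᵍ rep T₂⊆Tg)) h₂

  ⊨g-empty : ∀ {Tg} φ → (∀ s G → ¬ Tg s G) → _⊨g_ σ Tg φ
  ⊨g-empty (eq X x)   empty = lift λ s G g → ⊥-elim (empty s G g)
  ⊨g-empty (dep Xs Y) empty = lift λ s G _ _ g → ⊥-elim (empty s G g)
  ⊨g-empty (neg α)    empty = λ s G g → ⊥-elim (empty s G g)
  ⊨g-empty (φ ∧' ψ)   empty = ⊨g-empty φ empty , ⊨g-empty ψ empty
  ⊨g-empty (φ ∨' ψ)   empty = _ , _ , (λ _ _ g → g) , (λ _ _ g → g) , (λ _ _ → inj₁) ,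
                              ⊨g-empty φ empty , ⊨g-empty ψ empty
  ⊨g-empty (φ ⊔' ψ)   empty = inj₁ (⊨g-empty φ empty)
  ⊨g-empty (a □→ φ)   empty = inj₂ (⊨g-empty φ λ { t H (s , G , g , _) → empty s G g })

  ¬NonConst⇒Const : ¬ NonConst σ F V → (e : T (En F V)) → Const σ F V e
  ¬NonConst⇒Const {F} {V} ¬nonconstant e p q =
    decidable-stable (fn F V e p ≟ fn F V e q) λ differs →
      ¬nonconstant (e , λ constant → differs (constant p q))

  asGeneralized : ATeam σ → System σ → GTeam σ
  asGeneralized Tm F s G = Tm s × G ≡ F

  represents-asGeneralized : ∀ {Tm} → Represents Tm F (asGeneralized Tm F)
  represents-asGeneralized {F} = record
    { covers = λ ts → F , ts , refl
    ; member = proj₁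
    ; agrees = λ { (_ , refl) → agree-refl }
    }

  asGeneralized-⊨Φ : ∀ {Tm} → IsCausalTeam σ Tm F → _⊨gΦ_ σ (asGeneralized Tm F) F
  asGeneralized-⊨Φ {F} {Tm} (_ , compatible) = η , ξ
    where
    η : ∀ V (nc : NonConst σ F V) u → _⊨g_ σ (asGeneralized Tm F) (ηconj σ F V (proj₁ nc) u)
    η V (e , _) u = inj₂ (lift λ { t H (s , G , (_ , refl) , R , refl) → fixOthers-endogenous R e })
    -- V keeps its value when all other variables are fixed: it is exogenous, or
    -- its mechanism is constant and (by compatibility) returns s(V).
    frozen : ∀ {V u s t} → ¬ NonConst σ F V → Tm s → Result σ F (antOf σ V u) s t → t V ≡ s V
    frozen {V} {u} {s} ¬nonconstant ts R with T⊎≡false (En F V)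
    ... | inj₁ e  = trans (fixOthers-endogenous R e)
                          (trans (¬NonConst⇒Const {F = F} ¬nonconstant e _ _) (sym (compatible s ts V e)))
    ... | inj₂ ex = fixOthers-exogenous R ex
    ξ : ∀ V → ¬ NonConst σ F V → ∀ v u → _⊨g_ σ (asGeneralized Tm F) (ξconj σ V v u)
    ξ V ¬nonconstant v u =
      (λ s G → asGeneralized Tm F s G × s V ≢ v) , (λ s G → asGeneralized Tm F s G × s V ≡ v) ,
      (λ _ _ → proj₁) , (λ _ _ → proj₁) ,
      (λ s G g → case s V ≟ v of λ
        { (yes sV≡v) → inj₂ (g , sV≡v)
        ; (no sV≢v)  → inj₁ (g , sV≢v) }) ,
      (λ s G (_ , sV≢v) sat → sV≢v (lower sat s G (refl , refl))) ,
      inj₂ (lift λ { t H (s , G , ((ts , refl) , sV≡v) , R , refl) →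
                     trans (frozen ¬nonconstant ts R) sV≡v })

  ⊨ᵍ⇒⊨ᶜ : ∀ Γ ψ → _,⨆Φ⊨ᵍ_ σ Γ ψ → _⊨ᶜ_ σ Γ ψ
  ⊨ᵍ⇒⊨ᶜ Γ ψ ⊨ᵍψ Tm F causal Γ-holds =
    Equivalence.from (⊨-transfer ψ represents-asGeneralized)
      (⊨ᵍψ (asGeneralized Tm F) generalized
           (λ φ γ → Equivalence.to (⊨-transfer φ represents-asGeneralized) (Γ-holds φ γ))
           (F , asGeneralized-⊨Φ causal))
    where
    generalized : IsGTeam σ (asGeneralized Tm F)
    generalized s G (ts , refl) = proj₁ causal , proj₂ causal s ts

  module _ {Tg : GTeam σ} {F : System σ} (Φ : _⊨gΦ_ σ Tg F) where

    Φ-η : Tg s G → (nc : NonConst σ F V) → Result σ G (antOf σ V u) s t →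
          t V ≡ eval F V (proj₁ nc) u
    Φ-η g nc R with proj₁ Φ _ nc _
    ... | inj₁ (lift inconsistent) = ⊥-elim (antOf-consistent inconsistent)
    ... | inj₂ sat                 = lower sat _ _ (_ , _ , g , R , refl)

    Φ-ξ : Tg s G → ¬ NonConst σ F V → Result σ G (antOf σ V u) s t → t V ≡ s V
    Φ-ξ {s} {G} {V} {u} g ¬nonconstant R with proj₂ Φ V ¬nonconstant (s V) u
    ... | _ , _ , _ , _ , cover , h₁ , h₂ with cover s G g
    ...   | inj₁ g₁ = ⊥-elim (h₁ s G g₁ (lift λ { _ _ (refl , refl) → refl }))
    ...   | inj₂ g₂ with h₂
    ...     | inj₁ (lift inconsistent) = ⊥-elim (antOf-consistent inconsistent)
    ...     | inj₂ sat                 = lower sat _ _ (s , G , g₂ , R , refl)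

    mechanism-matches : Tg s G → (nc : NonConst σ F V) (e' : T (En G V)) →
                        ∀ u → eval G V e' u ≡ eval F V (proj₁ nc) u
    mechanism-matches {s} {G} {V} g nc e' u =
      let _ , R = fixOthers G s u V in trans (sym (fixOthers-endogenous R e')) (Φ-η g nc R)

    nonconstant⇒endogenous : Tg s G → NonConst σ F V → T (En G V)
    nonconstant⇒endogenous {s} {G} {V} g nc@(e , ¬constant) with T⊎≡false (En G V)
    ... | inj₁ e' = e'
    ... | inj₂ ex =
      ⊥-elim (¬constant (invariant⇒Const {F = F} λ u u' → trans (frozen u) (sym (frozen u'))))
      where
      frozen : ∀ u → eval F V e u ≡ s V
      frozen u = let _ , R = fixOthers G s u V in trans (sym (Φ-η g nc R)) (fixOthers-exogenous R ex)

    constant⇒frozen : Tg s G → ¬ NonConst σ F V → (e' : T (En G V)) → ∀ u → eval G V e' u ≡ s V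
    constant⇒frozen {s} {G} {V} g ¬nonconstant e' u =
      let _ , R = fixOthers G s u V in trans (sym (fixOthers-endogenous R e')) (Φ-ξ g ¬nonconstant R)

    agree-core : Tg s G → Agree (core F) G s
    agree-core g = record
      { endogenous = λ h → nonconstant⇒endogenous g (core-endogenous⇒NonConst {F = F} h)
      ; mechanism  = λ h e' u → trans (mechanism-matches g (core-endogenous⇒NonConst {F = F} h) e' u)
                                      (trans (eval-irrelevant {F = F} _ _ u) (sym (core-eval {F = F} h u)))
      ; exogenous  = λ ex → constant⇒frozen g (core-exogenous⇒¬NonConst {F = F} ex)
      }

    core-parent : Tg s G → Parent σ (core F) X V → Parent σ G X V
    core-parent {s} {G} {X} {V} g (h , X∈PA) with toWitness {a? = relevantParent? F V X} X∈PA
    ... | e , relevant@(u , x , differs) = eG , X∈PAG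
      where
      eG : T (En G V)
      eG = Agree.endogenous (agree-core g) h
      X∈PAG : T (PA G V X)
      X∈PAG with T⊎≡false (PA G V X)
      ... | inj₁ X∈PAG = X∈PAG
      ... | inj₂ X∉PAG = ⊥-elim (differs (begin
        eval F V e u               ≡⟨ sym (matches u) ⟩
        eval G V eG u              ≡⟨ sym (eval-update-nonparent {F = G} x (subst T X∉PAG)) ⟩
        eval G V eG (u [ X ≔ x ])  ≡⟨ matches (u [ X ≔ x ]) ⟩
        eval F V e (u [ X ≔ x ])   ∎))
        where
        open ≡-Reasoning
        matches : ∀ w → eval G V eG w ≡ eval F V e w
        matches = mechanism-matches g (e , relevant⇒¬Const {F = F} relevant) eG

  parent? : (F : System σ) → Decidable (Parent σ F)
  parent? F X V = T? (En F V) ×-dec T? (PA F V X)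

  ⊨ᶜ⇒⊨ᵍ : ∀ Γ ψ → _⊨ᶜ_ σ Γ ψ → _,⨆Φ⊨ᵍ_ σ Γ ψ
  ⊨ᶜ⇒⊨ᵍ Γ ψ ⊨ᶜψ Tg generalized Γ-holds (F , Φ)
    with Acyclicity.cyclic-or-acyclic (parent? (core F))
  ... | inj₁ (V , cycle) = ⊨g-empty ψ λ s G g →
          proj₁ (generalized s G g) V (TransClosure-map (core-parent Φ g) cycle)
  ... | inj₂ acyclic =
    Equivalence.to (⊨-transfer ψ represents)
      (⊨ᶜψ Tm (core F) causal λ φ γ → Equivalence.from (⊨-transfer φ represents) (Γ-holds φ γ))
    where
    Tm : ATeam σ
    Tm s = Σ (System σ) (Tg s)
    represents : Represents Tm (core F) Tg
    represents = record { covers = λ g → g ; member = λ g → _ , g ; agrees = agree-core Φ }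
    causal : IsCausalTeam σ Tm (core F)
    causal = acyclic , λ s (G , g) → agree-compatible (agree-core Φ g) (proj₂ (generalized s G g))

lemma3p7 : (σ : Sig) (L : Lang) (Γ : Fml σ → Set) (ψ : Fml σ) →
    (∀ φ → Γ φ → InLang σ L φ) → InLang σ L ψ →
    (_⊨ᶜ_ σ Γ ψ ⇔ _,⨆Φ⊨ᵍ_ σ Γ ψ)
-- The transfer between causal and generalized teams works for every formula.
lemma3p7 σ L Γ ψ _ _ = mk⇔ (⊨ᶜ⇒⊨ᵍ Γ ψ) (⊨ᵍ⇒⊨ᶜ Γ ψ)
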